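{- Let $m,n\in\mathbb{Z}_{\geq 0}$ and let $G_1^{g_1},\ldots,G_m^{g_m},H_1^{h_1},\ldots,H_n^{h_n}$ be games with activeness. The following are equivalent: (a) There exists a game $X^1$ (an active game) such that $o(G_i^{g_i}+X^1)=\mathscr{P}$ for every $i\in[m]$ and $o(H_j^{h_j}+X^1)=\mathscr{N}$ for every $j\in[n]$. (b) Both of the following hold: (b1) $G_i^{g_i}\bowtie G_j^{g_j}$ for all $i,j\in[m]$; (b2) $G_i^{g_i}\neq H_j^{h_j}$ for all $i\in[m]$, $j\in[n]$.
   Context: Let $\mathcal{B}=\{0,1\}$. Define $\mathbb{I}_0=\{\emptyset\}\times\mathcal{B}$ and $\mathbb{I}_n=2^{\mathbb{I}_{n-1}}\times\mathcal{B}$ for $n\ge1$; a game with activeness is an element of $\mathbb{I}=\bigcup_{n\ge0}\mathbb{I}_n$. A pair $(G,g)$ is written $G^g$; the elements of $G$ are the options of $G^g$ (written $G'^{g'}\in G^g$), and $g=1$ means active, $g=0$ inactive. The outcome $o:\mathbb{I}\to\{\mathscr{P},\mathscr{N}\}$ is defined recursively by $o(G^g)=\mathscr{N}$ if $g=1$ and some option $G'^{g'}\in G^g$ has $o(G'^{g'})=\mathscr{P}$, and $o(G^g)=\mathscr{P}$ otherwise (i.e. if $g=0$ or all options are in $\mathscr{N}$). The sum is defined recursively by $G^g+H^h=(\{G'^{g'}+H^h:G'^{g'}\in G^g\}\cup\{G^g+H'^{h'}:H'^{h'}\in H^h\})^{\max\{g,h\}}$. Write $G^g=H^h$ iff $o(G^g+X^x)=o(H^h+X^x)$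 for all $X^x\in\mathbb{I}$, and $G^g\neq H^h$ otherwise. Write $G^g\bowtie H^h$ iff (1) $G'^{g'}\neq H^h$ for every option $G'^{g'}$ of $G^g$, and (2) $G^g\neq H'^{h'}$ for every option $H'^{h'}$ of $H^h$. $[k]=\{1,\dots,k\}$. -}

module Defs where

open import Data.Bool using (Bool; true; false; _∨_)
open import Data.List using (List; []; _∷_; _++_)
open import Data.List.Membership.Propositional using (_∈_)
open import Data.Product using (_×_)
open import Relation.Binary.PropositionalEquality using (_≡_)
open import Relation.Nullary using (¬_)

-- A game with activeness G^g: a finite collection of options (games) and
-- an activeness bit g (true = active = 1, false = inactive = 0).
-- Hereditarily finite sets are represented by lists of options; all
-- notions below (outcome, sum, equality) are invariant under reordering
-- and duplication of options.
data Game : Set where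
  mk : List Game → Bool → Game

options : Game → List Game
options (mk Gs _) = Gs

data Outcome : Set where
  𝒫 𝒩 : Outcome

mutual
  o : Game → Outcome
  o (mk Gs true)  = oActive Gs
  o (mk Gs false) = 𝒫

  oActive : List Game → Outcome
  oActive []       = 𝒫
  oActive (G ∷ Gs) with o G
  ... | 𝒫 = 𝒩
  ... | 𝒩 = oActive Gs

-- Disjunctive sum G^g + H^h, defined by nested structural recursion:
-- outer recursion on G, inner recursion on H.
-- sumWith Gs g fs H computes (Gs)^g + H, where fs lists the functions
-- (G' +_) for the options G' ∈ Gs.
applyAll : List (Game → Game) → Game → List Game
applyAll []       X = []
applyAll (f ∷ fs) X = f X ∷ applyAll fs X

mutual
  sumWith : List Game → Bool → List (Game → Game) → Game → Game
  sumWith Gs g fs (mk Hs h) =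
    mk (applyAll fs (mk Hs h) ++ sumWithL Gs g fs Hs) (g ∨ h)

  sumWithL : List Game → Bool → List (Game → Game) → List Game → List Game
  sumWithL Gs g fs []        = []
  sumWithL Gs g fs (H' ∷ Hs) = sumWith Gs g fs H' ∷ sumWithL Gs g fs Hs

mutual
  _⊕_ : Game → Game → Game
  mk Gs g ⊕ H = sumWith Gs g (sumL Gs) H

  sumL : List Game → List (Game → Game)
  sumL []        = []
  sumL (G' ∷ Gs) = (G' ⊕_) ∷ sumL Gs

-- Unfolding: mk Gs g ⊕ mk Hs h has options
--   { G' ⊕ mk Hs h : G' ∈ Gs } ++ { mk Gs g ⊕ H' : H' ∈ Hs }
-- and activeness g ∨ h.

_≈_ : Game → Game → Set
G ≈ H = ∀ X → o (G ⊕ X) ≡ o (H ⊕ X)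

_⋈_ : Game → Game → Set
G ⋈ H = (∀ {G'} → G' ∈ options G → ¬ (G' ≈ H))
      × (∀ {H'} → H' ∈ options H → ¬ (G ≈ H'))

-- (a) ⇒ (b): if X is active and o(G ⊕ X) = 𝒫, every move G' ⊕ X from G ⊕ X must lead to 𝒩; so
-- no option G' of G can equal a game H with o(H ⊕ X) = 𝒫, and no H with o(H ⊕ X) = 𝒩 can equal G.
--
-- (b) ⇒ (a): call t a target if t is an option of some Gᵢ or one of the Hⱼ; by (b) no target equals
-- any Gₖ. For each target t we build an active Y with o(t ⊕ Y) = 𝒫 and o(Gₖ ⊕ Y) = 𝒩 for all k: its
-- options are, for each k, an active game X with o(Gₖ ⊕ X) = 𝒫 and o(t ⊕ X) = 𝒩, together with the
-- mirror images of the options of t (answering t' by mirror t' and vice versa). The game whose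
-- options are all these Y is the required X¹.
--
-- A game telling Gₖ from t must be exhibited, not merely shown to exist. Let S be the finite set of
-- subgames of Gₖ and t. The outcome profile (o(K ⊕ X))_{K ∈ S} of mk Xs b depends only on b and the
-- set of profiles of Xs, so the profiles realised by games of depth k grow with k inside a finite
-- set and stabilise; past that depth every profile is realised, and equality is a finite check.

module Submission where

open import Defs
open import Data.Bool using (Bool; true; false; _∨_)
open import Data.Bool.Properties using (∨-zeroʳ)
open import Data.Empty using (⊥-elim)
open import Data.Fin using (Fin)
open import Data.List using (List; []; _∷_; _++_; map; filter; length; tabulate; concat; cartesianProductWith)
import Data.List.Membership.DecPropositional as DecMembership
open import Data.List.Membership.Propositional using (_∈_; find; lose)
open import Data.List.Membership.Propositional.Properties
  using (∈-map⁺; ∈-map⁻; ∈-++⁺ˡ; ∈-++⁺ʳ; ∈-++⁻; ∈-filter⁺; ∈-filter⁻; ∈-tabulate⁺; ∈-tabulate⁻;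
         ∈-concat⁺′; ∈-concat⁻′; ∈-cartesianProductWith⁺; ∈-cartesianProductWith⁻)
open import Data.List.Properties using (≡-dec; ∷-injective; map-cong-local; length-map; length-filter)
open import Data.List.Relation.Binary.Subset.Propositional using (_⊆_)
open import Data.List.Relation.Binary.Subset.Propositional.Properties using () renaming (map⁺ to map-⊆)
open import Data.List.Relation.Unary.All as All using (All; []; _∷_; all?)
open import Data.List.Relation.Unary.All.Properties
  using (¬All⇒Any¬) renaming (map⁺ to All-map⁺; tabulate⁺ to All-tabulate⁺)
open import Data.List.Relation.Unary.Any using (Any; here; there)
open import Data.Nat using (ℕ; zero; suc; _+_; _≤_; _<_; z≤n; s≤s)
open import Data.Nat.Properties using (≤-trans; ≤-reflexive; ≤⇒≯; +-suc; +-identityʳ; +-monoˡ-≤; m≤n+m; m≤n⇒m≤1+n)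
open import Data.Product using (Σ; ∃; ∃-syntax; _×_; _,_; proj₁; proj₂)
open import Data.Sum using (_⊎_; inj₁; inj₂)
open import Function.Base using (_∘_)
open import Function.Bundles using (_⇔_; mk⇔; Equivalence)
open import Relation.Binary.PropositionalEquality using (_≡_; _≢_; refl; sym; trans; cong; subst; module ≡-Reasoning)
open import Relation.Nullary using (¬_; Dec; yes; no)
open import Relation.Unary using (Decidable)

map-≡⁻ : ∀ {A B : Set} {f g : A → B} {xs x} → map f xs ≡ map g xs → x ∈ xs → f x ≡ g x
map-≡⁻ {xs = _ ∷ _} eq (here refl) = proj₁ (∷-injective eq)
map-≡⁻ {xs = _ ∷ _} eq (there x∈)  = map-≡⁻ (proj₂ (∷-injective eq)) x∈

sublists : ∀ {A : Set} → List A → List (List A)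
sublists []       = [] ∷ []
sublists (x ∷ xs) = map (x ∷_) (sublists xs) ++ sublists xs

filter∈sublists : ∀ {A : Set} {P : A → Set} (P? : Decidable P) xs → filter P? xs ∈ sublists xs
filter∈sublists P? []       = here refl
filter∈sublists P? (x ∷ xs) with P? x
... | yes _ = ∈-++⁺ˡ (∈-map⁺ (x ∷_) (filter∈sublists P? xs))
... | no _  = ∈-++⁺ʳ (map (x ∷_) (sublists xs)) (filter∈sublists P? xs)

∈-sublists⇒⊆ : ∀ {A : Set} (xs : List A) {ys} → ys ∈ sublists xs → ys ⊆ xs
∈-sublists⇒⊆ []       (here refl) ()
∈-sublists⇒⊆ (x ∷ xs) ys∈ y∈ with ∈-++⁻ (map (x ∷_) (sublists xs)) ys∈
... | inj₂ ys∈′ = there (∈-sublists⇒⊆ xs ys∈′ y∈)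
... | inj₁ x∷ys∈ with _ , ys∈′ , refl ← ∈-map⁻ (x ∷_) x∷ys∈ with y∈
...   | here refl = here refl
...   | there y∈′ = there (∈-sublists⇒⊆ xs ys∈′ y∈′)

module _ {A : Set} {P Q : A → Set} (P? : Decidable P) (Q? : Decidable Q) (P⇒Q : ∀ {x} → P x → Q x) where
  length-filter-mono-≤ : ∀ xs → length (filter P? xs) ≤ length (filter Q? xs)
  length-filter-mono-≤ []       = z≤n
  length-filter-mono-≤ (x ∷ xs) with P? x | Q? x
  ... | yes _  | yes _  = s≤s (length-filter-mono-≤ xs)
  ... | yes px | no ¬qx = ⊥-elim (¬qx (P⇒Q px))
  ... | no _   | yes _  = m≤n⇒m≤1+n (length-filter-mono-≤ xs)
  ... | no _   | no _   = length-filter-mono-≤ xs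

  length-filter-mono-< : ∀ {x xs} → x ∈ xs → Q x → ¬ P x → length (filter P? xs) < length (filter Q? xs)
  length-filter-mono-< {xs = y ∷ xs} (here refl) qy ¬py with P? y | Q? y
  ... | yes py | _      = ⊥-elim (¬py py)
  ... | no _   | no ¬qy = ⊥-elim (¬qy qy)
  ... | no _   | yes _  = s≤s (length-filter-mono-≤ xs)
  length-filter-mono-< {xs = y ∷ xs} (there x∈) qx ¬px with P? y | Q? y
  ... | yes _  | yes _  = s≤s (length-filter-mono-< x∈ qx ¬px)
  ... | yes py | no ¬qy = ⊥-elim (¬qy (P⇒Q py))
  ... | no _   | yes _  = m≤n⇒m≤1+n (length-filter-mono-< x∈ qx ¬px)
  ... | no _   | no _   = length-filter-mono-< x∈ qx ¬px

stabilises : (P : ℕ → Set) (c : ℕ → ℕ) (B : ℕ) → (∀ k → c k ≤ B) → (∀ k → P k ⊎ c k < c (suc k)) → ∃ P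
stabilises P c B c≤B grows = search (suc B) 0 (m≤n+m (suc B) (c 0))
  where
  search : ∀ fuel k → B < c k + fuel → ∃ P
  search zero k B<c = ⊥-elim (≤⇒≯ (c≤B k) (subst (B <_) (+-identityʳ (c k)) B<c))
  search (suc fuel) k B<c with grows k
  ... | inj₁ Pk = k , Pk
  ... | inj₂ c< = search fuel (suc k) (≤-trans B<c (≤-trans (≤-reflexive (+-suc (c k) fuel)) (+-monoˡ-≤ fuel c<)))

∈-bools : ∀ b → b ∈ false ∷ true ∷ []
∈-bools false = here refl
∈-bools true  = there (here refl)

module _ (P : Game → Set) (step : ∀ Gs g → All P Gs → P (mk Gs g)) where
  mutual
    Game-ind : ∀ G → P G
    Game-ind (mk Gs g) = step Gs g (All-ind Gs)

    All-ind : ∀ Gs → All P Gs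
    All-ind []       = []
    All-ind (G ∷ Gs) = Game-ind G ∷ All-ind Gs

active : Game → Bool
active (mk _ g) = g

applyAll-sumL : ∀ Gs X → applyAll (sumL Gs) X ≡ map (_⊕ X) Gs
applyAll-sumL []       X = refl
applyAll-sumL (G ∷ Gs) X = cong (G ⊕ X ∷_) (applyAll-sumL Gs X)

sumWithL-sumL : ∀ Gs g Xs → sumWithL Gs g (sumL Gs) Xs ≡ map (mk Gs g ⊕_) Xs
sumWithL-sumL Gs g []       = refl
sumWithL-sumL Gs g (X ∷ Xs) = cong (mk Gs g ⊕ X ∷_) (sumWithL-sumL Gs g Xs)

options-⊕ : ∀ G X → options (G ⊕ X) ≡ map (_⊕ X) (options G) ++ map (G ⊕_) (options X)
options-⊕ (mk Gs g) (mk Xs x)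
  rewrite applyAll-sumL Gs (mk Xs x) | sumWithL-sumL Gs g Xs = refl

∈-options-⊕⁺ˡ : ∀ G X {G'} → G' ∈ options G → G' ⊕ X ∈ options (G ⊕ X)
∈-options-⊕⁺ˡ G X G'∈ = subst (_ ∈_) (sym (options-⊕ G X)) (∈-++⁺ˡ (∈-map⁺ (_⊕ X) G'∈))

∈-options-⊕⁺ʳ : ∀ G X {X'} → X' ∈ options X → G ⊕ X' ∈ options (G ⊕ X)
∈-options-⊕⁺ʳ G X X'∈ =
  subst (_ ∈_) (sym (options-⊕ G X)) (∈-++⁺ʳ (map (_⊕ X) (options G)) (∈-map⁺ (G ⊕_) X'∈))

∈-options-⊕⁻ : ∀ G X {A} → A ∈ options (G ⊕ X) →
               (∃[ G' ] G' ∈ options G × A ≡ G' ⊕ X) ⊎ (∃[ X' ] X' ∈ options X × A ≡ G ⊕ X')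
∈-options-⊕⁻ G X A∈ with ∈-++⁻ (map (_⊕ X) (options G)) (subst (_ ∈_) (options-⊕ G X) A∈)
... | inj₁ A∈ˡ = inj₁ (∈-map⁻ (_⊕ X) A∈ˡ)
... | inj₂ A∈ʳ = inj₂ (∈-map⁻ (G ⊕_) A∈ʳ)

𝒫≢𝒩 : 𝒫 ≢ 𝒩
𝒫≢𝒩 ()

_≟ₒ_ : (r s : Outcome) → Dec (r ≡ s)
𝒫 ≟ₒ 𝒫 = yes refl
𝒫 ≟ₒ 𝒩 = no λ ()
𝒩 ≟ₒ 𝒫 = no λ ()
𝒩 ≟ₒ 𝒩 = yes refl

∈-outcomes : ∀ r → r ∈ 𝒫 ∷ 𝒩 ∷ []
∈-outcomes 𝒫 = here refl
∈-outcomes 𝒩 = there (here refl)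

outcomeLists : ℕ → List (List Outcome)
outcomeLists zero    = [] ∷ []
outcomeLists (suc n) = cartesianProductWith _∷_ (𝒫 ∷ 𝒩 ∷ []) (outcomeLists n)

∈-outcomeLists : ∀ rs → rs ∈ outcomeLists (length rs)
∈-outcomeLists []       = here refl
∈-outcomeLists (r ∷ rs) = ∈-cartesianProductWith⁺ _∷_ (∈-outcomes r) (∈-outcomeLists rs)

outcome-≡ : ∀ {r s} → (r ≡ 𝒩 → s ≡ 𝒩) → (s ≡ 𝒩 → r ≡ 𝒩) → r ≡ s
outcome-≡ {𝒫} {𝒫} _ _ = refl
outcome-≡ {𝒫} {𝒩} _ s⇒r = s⇒r refl
outcome-≡ {𝒩} {𝒫} r⇒s _ = sym (r⇒s refl)
outcome-≡ {𝒩} {𝒩} _ _ = refl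

oActive≡𝒩⇔ : ∀ As → oActive As ≡ 𝒩 ⇔ Any (λ A → o A ≡ 𝒫) As
oActive≡𝒩⇔ []       = mk⇔ (λ ()) (λ ())
oActive≡𝒩⇔ (A ∷ As) with o A in oA
... | 𝒫 = mk⇔ (λ _ → here oA) (λ _ → refl)
... | 𝒩 = mk⇔ (λ p → there (to p)) λ where
    (here oA≡𝒫) → ⊥-elim (𝒫≢𝒩 (trans (sym oA≡𝒫) oA))
    (there p)   → from p
  where open Equivalence (oActive≡𝒩⇔ As)

o≡𝒩⇔ : ∀ A → o A ≡ 𝒩 ⇔ (active A ≡ true × Any (λ A' → o A' ≡ 𝒫) (options A))
o≡𝒩⇔ (mk As true)  = mk⇔ (λ oA → refl , to oA) (λ (_ , p) → from p)
  where open Equivalence (oActive≡𝒩⇔ As)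
o≡𝒩⇔ (mk As false) = mk⇔ (λ ()) (λ ())

o-𝒩 : ∀ A {A'} → active A ≡ true → A' ∈ options A → o A' ≡ 𝒫 → o A ≡ 𝒩
o-𝒩 A act A'∈ oA' = Equivalence.from (o≡𝒩⇔ A) (act , lose A'∈ oA')

o-𝒫 : ∀ A → (∀ {A'} → A' ∈ options A → o A' ≡ 𝒩) → o A ≡ 𝒫
o-𝒫 A options-𝒩 with o A in oA
... | 𝒫 = refl
... | 𝒩 with _ , A'∈ , oA'≡𝒫 ← find (proj₂ (Equivalence.to (o≡𝒩⇔ A) oA)) =
  ⊥-elim (𝒫≢𝒩 (trans (sym oA'≡𝒫) (options-𝒩 A'∈)))

⊕-active : ∀ G X → active X ≡ true → active (G ⊕ X) ≡ true
⊕-active (mk Gs g) (mk Xs true) refl = ∨-zeroʳ g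

⊕-𝒫 : ∀ G X → (∀ {G'} → G' ∈ options G → o (G' ⊕ X) ≡ 𝒩) → (∀ {X'} → X' ∈ options X → o (G ⊕ X') ≡ 𝒩) →
      o (G ⊕ X) ≡ 𝒫
⊕-𝒫 G X left-𝒩 right-𝒩 = o-𝒫 (G ⊕ X) λ A∈ → option-𝒩 (∈-options-⊕⁻ G X A∈)
  where
  option-𝒩 : ∀ {A} → (∃[ G' ] G' ∈ options G × A ≡ G' ⊕ X) ⊎ (∃[ X' ] X' ∈ options X × A ≡ G ⊕ X') → o A ≡ 𝒩
  option-𝒩 (inj₁ (_ , G'∈ , refl)) = left-𝒩 G'∈
  option-𝒩 (inj₂ (_ , X'∈ , refl)) = right-𝒩 X'∈

⊕-𝒩ˡ : ∀ G X {G'} → active X ≡ true → G' ∈ options G → o (G' ⊕ X) ≡ 𝒫 → o (G ⊕ X) ≡ 𝒩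
⊕-𝒩ˡ G X act G'∈ = o-𝒩 (G ⊕ X) (⊕-active G X act) (∈-options-⊕⁺ˡ G X G'∈)

⊕-𝒩ʳ : ∀ G X {X'} → active X ≡ true → X' ∈ options X → o (G ⊕ X') ≡ 𝒫 → o (G ⊕ X) ≡ 𝒩
⊕-𝒩ʳ G X act X'∈ = o-𝒩 (G ⊕ X) (⊕-active G X act) (∈-options-⊕⁺ʳ G X X'∈)

mutual
  mirror : Game → Game
  mirror (mk Gs _) = mk (mirrors Gs) true

  mirrors : List Game → List Game
  mirrors []       = []
  mirrors (G ∷ Gs) = mirror G ∷ mirrors Gs

mirror-active : ∀ G → active (mirror G) ≡ true
mirror-active (mk _ _) = refl

∈-mirrors⁺ : ∀ {G Gs} → G ∈ Gs → mirror G ∈ mirrors Gs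
∈-mirrors⁺ (here refl) = here refl
∈-mirrors⁺ (there G∈)  = there (∈-mirrors⁺ G∈)

∈-mirrors⁻ : ∀ Gs {Y} → Y ∈ mirrors Gs → ∃[ G ] G ∈ Gs × Y ≡ mirror G
∈-mirrors⁻ (G ∷ Gs) (here refl) = G , here refl , refl
∈-mirrors⁻ (G ∷ Gs) (there Y∈) with G' , G'∈ , refl ← ∈-mirrors⁻ Gs Y∈ = G' , there G'∈ , refl

-- Mirror strategy: a move to G' ⊕ X is answered by G' ⊕ mirror G', and a move to G ⊕ mirror G' by the same.
⊕-mirrors-𝒫 : ∀ G Zs → (∀ {G'} → G' ∈ options G → o (G' ⊕ mirror G') ≡ 𝒫) →
              All (λ Z → o (G ⊕ Z) ≡ 𝒩) Zs → o (G ⊕ mk (Zs ++ mirrors (options G)) true) ≡ 𝒫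
⊕-mirrors-𝒫 G Zs mirror-𝒫 Zs-𝒩 = ⊕-𝒫 G X left-𝒩 right-𝒩
  where
  X : Game
  X = mk (Zs ++ mirrors (options G)) true

  left-𝒩 : ∀ {G'} → G' ∈ options G → o (G' ⊕ X) ≡ 𝒩
  left-𝒩 {G'} G'∈ = ⊕-𝒩ʳ G' X refl (∈-++⁺ʳ Zs (∈-mirrors⁺ G'∈)) (mirror-𝒫 G'∈)

  right-𝒩 : ∀ {X'} → X' ∈ Zs ++ mirrors (options G) → o (G ⊕ X') ≡ 𝒩
  right-𝒩 X'∈ with ∈-++⁻ Zs X'∈
  ... | inj₁ Z∈ = All.lookup Zs-𝒩 Z∈
  ... | inj₂ Y∈ with G' , G'∈ , refl ← ∈-mirrors⁻ (options G) Y∈ =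
    ⊕-𝒩ˡ G (mirror G') (mirror-active G') G'∈ (mirror-𝒫 G'∈)

⊕-mirror-𝒫 : ∀ G → o (G ⊕ mirror G) ≡ 𝒫
⊕-mirror-𝒫 = Game-ind _ λ Gs g ih → ⊕-mirrors-𝒫 (mk Gs g) [] (All.lookup ih) []

Separates : Game → Game → Game → Set
Separates X G H = o (G ⊕ X) ≡ 𝒫 × o (H ⊕ X) ≡ 𝒩

separates-swap : ∀ Z G H → Separates Z G H → Separates (mk (Z ∷ mirrors (options H)) true) H G
separates-swap Z G H (G⊕Z , H⊕Z) =
  ⊕-mirrors-𝒫 H (Z ∷ []) (λ {H'} _ → ⊕-mirror-𝒫 H') (H⊕Z ∷ []) ,
  ⊕-𝒩ʳ G (mk (Z ∷ mirrors (options H)) true) refl (here refl) G⊕Z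

mutual
  subgames : Game → List Game
  subgames (mk Gs g) = mk Gs g ∷ subgamesL Gs

  subgamesL : List Game → List Game
  subgamesL []       = []
  subgamesL (G ∷ Gs) = subgames G ++ subgamesL Gs

∈-subgamesL : ∀ Gs {G} → G ∈ Gs → G ∈ subgamesL Gs
∈-subgamesL (mk _ _ ∷ _) (here refl) = here refl
∈-subgamesL (G ∷ Gs)     (there G∈)  = ∈-++⁺ʳ (subgames G) (∈-subgamesL Gs G∈)

mutual
  subgames-closed : ∀ G {A A'} → A ∈ subgames G → A' ∈ options A → A' ∈ subgames G
  subgames-closed (mk Gs g) (here refl) A'∈ = there (∈-subgamesL Gs A'∈)
  subgames-closed (mk Gs g) (there A∈)  A'∈ = there (subgamesL-closed Gs A∈ A'∈)

  subgamesL-closed : ∀ Gs {A A'} → A ∈ subgamesL Gs → A' ∈ options A → A' ∈ subgamesL Gs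
  subgamesL-closed (G ∷ Gs) A∈ A'∈ with ∈-++⁻ (subgames G) A∈
  ... | inj₁ A∈ˡ = ∈-++⁺ˡ (subgames-closed G A∈ˡ A'∈)
  ... | inj₂ A∈ʳ = ∈-++⁺ʳ (subgames G) (subgamesL-closed Gs A∈ʳ A'∈)

⊕-agree? : ∀ G H → Decidable (λ Z → o (G ⊕ Z) ≡ o (H ⊕ Z))
⊕-agree? G H Z = o (G ⊕ Z) ≟ₒ o (H ⊕ Z)

module Profiles (S : List Game) (S-closed : ∀ {K K'} → K ∈ S → K' ∈ options K → K' ∈ S) where

  open DecMembership (≡-dec _≟ₒ_) using (_∈?_)

  profile : Game → List Outcome
  profile X = map (λ K → o (K ⊕ X)) S

  profile-≡⇒ : ∀ {X Y K} → profile X ≡ profile Y → K ∈ S → o (K ⊕ X) ≡ o (K ⊕ Y)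
  profile-≡⇒ = map-≡⁻

  ⊕-𝒩-transfer : ∀ K {Xs Ys b} → K ∈ S →
                 (∀ {K'} → K' ∈ options K → o (K' ⊕ mk Xs b) ≡ o (K' ⊕ mk Ys b)) →
                 map profile Xs ⊆ map profile Ys →
                 o (K ⊕ mk Xs b) ≡ 𝒩 → o (K ⊕ mk Ys b) ≡ 𝒩
  -- act is reused for the second sum: both have activeness k ∨ b.
  ⊕-𝒩-transfer (mk Ks k) {Xs} {Ys} {b} K∈ same Xs⊆Ys K⊕X≡𝒩
    with act , win ← Equivalence.to (o≡𝒩⇔ (mk Ks k ⊕ mk Xs b)) K⊕X≡𝒩
    with A , A∈ , A≡𝒫 ← find win
    with ∈-options-⊕⁻ (mk Ks k) (mk Xs b) A∈
  ... | inj₁ (K' , K'∈ , refl) =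
    o-𝒩 (mk Ks k ⊕ mk Ys b) act (∈-options-⊕⁺ˡ (mk Ks k) (mk Ys b) K'∈) (trans (sym (same K'∈)) A≡𝒫)
  ... | inj₂ (X' , X'∈ , refl) with Y' , Y'∈ , X'~Y' ← ∈-map⁻ profile (Xs⊆Ys (∈-map⁺ profile X'∈)) =
    o-𝒩 (mk Ks k ⊕ mk Ys b) act (∈-options-⊕⁺ʳ (mk Ks k) (mk Ys b) Y'∈) (trans (sym (profile-≡⇒ X'~Y' K∈)) A≡𝒫)

  profile-cong : ∀ Xs Ys b → map profile Xs ⊆ map profile Ys → map profile Ys ⊆ map profile Xs →
                 profile (mk Xs b) ≡ profile (mk Ys b)
  profile-cong Xs Ys b Xs⊆Ys Ys⊆Xs = map-cong-local (All.tabulate λ {K} K∈ → Game-ind P step K K∈)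
    where
    P : Game → Set
    P K = K ∈ S → o (K ⊕ mk Xs b) ≡ o (K ⊕ mk Ys b)

    step : ∀ Ks k → All P Ks → P (mk Ks k)
    step Ks k ih K∈ = outcome-≡ (⊕-𝒩-transfer (mk Ks k) K∈ same Xs⊆Ys)
                                (⊕-𝒩-transfer (mk Ks k) K∈ (λ K'∈ → sym (same K'∈)) Ys⊆Xs)
      where
      same : ∀ {K'} → K' ∈ Ks → o (K' ⊕ mk Xs b) ≡ o (K' ⊕ mk Ys b)
      same K'∈ = All.lookup ih K'∈ (S-closed K∈ K'∈)

  collapse : ∀ L Ws b → map profile Ws ⊆ map profile L →
             ∃[ Ws' ] Ws' ∈ sublists L × profile (mk Ws' b) ≡ profile (mk Ws b)
  collapse L Ws b Ws⊆L = Ws' , filter∈sublists P? L , profile-cong Ws' Ws b Ws'⊆Ws Ws⊆Ws'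
    where
    P? : Decidable (λ Y → profile Y ∈ map profile Ws)
    P? Y = profile Y ∈? map profile Ws

    Ws' : List Game
    Ws' = filter P? L

    Ws'⊆Ws : map profile Ws' ⊆ map profile Ws
    Ws'⊆Ws v∈ with Y , Y∈ , refl ← ∈-map⁻ profile v∈ = proj₂ (∈-filter⁻ P? {xs = L} Y∈)

    Ws⊆Ws' : map profile Ws ⊆ map profile Ws'
    Ws⊆Ws' v∈ with Y , Y∈ , refl ← ∈-map⁻ profile (Ws⊆L v∈) = ∈-map⁺ profile (∈-filter⁺ P? Y∈ v∈)

  level : ℕ → List Game
  level zero    = []
  level (suc k) = cartesianProductWith mk (sublists (level k)) (false ∷ true ∷ [])

  realised : ℕ → List (List Outcome)
  realised k = map profile (level k)

  mk-realised : ∀ k Ws b → map profile Ws ⊆ realised k → profile (mk Ws b) ∈ realised (suc k)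
  mk-realised k Ws b Ws⊆ with Ws' , Ws'∈ , same ← collapse (level k) Ws b Ws⊆ =
    subst (_∈ realised (suc k)) same (∈-map⁺ profile (∈-cartesianProductWith⁺ mk Ws'∈ (∈-bools b)))

  realised-suc-mono : ∀ i j → realised j ⊆ realised i → realised (suc j) ⊆ realised (suc i)
  realised-suc-mono i j j⊆i v∈
    with Z , Z∈ , refl ← ∈-map⁻ profile v∈
    with Ws , b , Ws∈ , _ , refl ← ∈-cartesianProductWith⁻ mk (sublists (level j)) _ Z∈ =
    mk-realised i Ws b (λ w∈ → j⊆i (map-⊆ profile (∈-sublists⇒⊆ (level j) Ws∈) w∈))

  realised-mono : ∀ k → realised k ⊆ realised (suc k)
  realised-mono zero    ()
  realised-mono (suc k) = realised-suc-mono (suc k) k (realised-mono k)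

  Stable : ℕ → Set
  Stable k = realised (suc k) ⊆ realised k

  universe : List (List Outcome)
  universe = outcomeLists (length S)

  profile∈universe : ∀ X → profile X ∈ universe
  profile∈universe X = subst (λ n → profile X ∈ outcomeLists n) (length-map _ S) (∈-outcomeLists (profile X))

  count : ℕ → ℕ
  count k = length (filter (_∈? realised k) universe)

  stable-or-grows : ∀ k → Stable k ⊎ count k < count (suc k)
  stable-or-grows k with all? (_∈? realised k) (realised (suc k))
  ... | yes all∈ = inj₁ (All.lookup all∈)
  ... | no ¬all∈
    with v , v∈ , v∉ ← find (¬All⇒Any¬ (_∈? realised k) _ ¬all∈)
    with Z , _ , refl ← ∈-map⁻ profile v∈ =
    inj₂ (length-filter-mono-< (_∈? realised k) (_∈? realised (suc k)) (realised-mono k) (profile∈universe Z) v∈ v∉)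

  stable-level : ∃ Stable
  stable-level =
    stabilises Stable count (length universe) (λ k → length-filter (_∈? realised k) universe) stable-or-grows

  k₀ : ℕ
  k₀ = proj₁ stable-level

  profile-realised : ∀ X → profile X ∈ realised k₀
  profile-realised = Game-ind _ λ Xs b ih → proj₂ stable-level (mk-realised k₀ Xs b (All.lookup (All-map⁺ ih)))

  ≈-or-distinguished : ∀ G H → G ∈ S → H ∈ S → G ≈ H ⊎ ∃[ Z ] o (G ⊕ Z) ≢ o (H ⊕ Z)
  ≈-or-distinguished G H G∈ H∈ with all? (⊕-agree? G H) (level k₀)
  ... | no ¬agree = inj₂ (let Z , _ , G≢H = find (¬All⇒Any¬ (⊕-agree? G H) _ ¬agree) in Z , G≢H)
  ... | yes agree = inj₁ λ X → let Z , Z∈ , X~Z = ∈-map⁻ profile (profile-realised X) in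
    begin
      o (G ⊕ X) ≡⟨ profile-≡⇒ X~Z G∈ ⟩
      o (G ⊕ Z) ≡⟨ All.lookup agree Z∈ ⟩
      o (H ⊕ Z) ≡⟨ profile-≡⇒ (sym X~Z) H∈ ⟩
      o (H ⊕ X) ∎
    where open ≡-Reasoning

≉⇒distinguished : ∀ G H → ¬ G ≈ H → ∃[ Z ] o (G ⊕ Z) ≢ o (H ⊕ Z)
≉⇒distinguished G H G≉H
  with Profiles.≈-or-distinguished (subgamesL (G ∷ H ∷ [])) (subgamesL-closed (G ∷ H ∷ [])) G H
         (∈-subgamesL (G ∷ H ∷ []) (here refl)) (∈-subgamesL (G ∷ H ∷ []) (there (here refl)))
... | inj₁ G≈H          = ⊥-elim (G≉H G≈H)
... | inj₂ distinguished = distinguished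

≉⇒separated : ∀ G H → ¬ G ≈ H → ∃[ Xs ] Separates (mk Xs true) G H
≉⇒separated G H G≉H with Z , G≢H ← ≉⇒distinguished G H G≉H with o (G ⊕ Z) in G⊕Z | o (H ⊕ Z) in H⊕Z
... | 𝒫 | 𝒫 = ⊥-elim (G≢H refl)
... | 𝒩 | 𝒩 = ⊥-elim (G≢H refl)
... | 𝒩 | 𝒫 = _ , separates-swap Z H G (H⊕Z , G⊕Z)
... | 𝒫 | 𝒩 = _ , separates-swap _ H G (separates-swap Z G H (G⊕Z , H⊕Z))

module _ {m} (G : Fin m → Game) where

  Safe : Game → Set
  Safe Y = ∀ k → o (G k ⊕ Y) ≡ 𝒩

  safe-refuter : ∀ t → (∀ k → ¬ G k ≈ t) → ∃[ Y ] Safe Y × o (t ⊕ Y) ≡ 𝒫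
  safe-refuter t G≉t =
    Y , safe , ⊕-mirrors-𝒫 t Zs (λ {t'} _ → ⊕-mirror-𝒫 t') (All-tabulate⁺ λ k → proj₂ (proj₂ (separated k)))
    where
    separated : ∀ k → ∃[ Xs ] Separates (mk Xs true) (G k) t
    separated k = ≉⇒separated (G k) t (G≉t k)

    Zs : List Game
    Zs = tabulate (λ k → mk (proj₁ (separated k)) true)

    Y : Game
    Y = mk (Zs ++ mirrors (options t)) true

    safe : Safe Y
    safe k = ⊕-𝒩ʳ (G k) Y refl (∈-++⁺ˡ (∈-tabulate⁺ k)) (proj₁ (proj₂ (separated k)))

  safe-refuters : ∀ T → (∀ {t} → t ∈ T → ∀ k → ¬ G k ≈ t) →
                  ∃[ Ys ] All Safe Ys × All (λ t → Any (λ Y → o (t ⊕ Y) ≡ 𝒫) Ys) T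
  safe-refuters []      _   = [] , [] , []
  safe-refuters (t ∷ T) G≉T
    with Y , safe , t⊕Y ← safe-refuter t (G≉T (here refl))
    with Ys , safes , refuted ← safe-refuters T (λ t∈ → G≉T (there t∈)) =
    Y ∷ Ys , safe ∷ safes , here t⊕Y ∷ All.map there refuted

  safe-separator : ∀ T → (∀ {t} → t ∈ T → ∀ k → ¬ G k ≈ t) → (∀ i {G'} → G' ∈ options (G i) → G' ∈ T) →
                   ∃[ Xs ] (∀ i → o (G i ⊕ mk Xs true) ≡ 𝒫) × (∀ {t} → t ∈ T → o (t ⊕ mk Xs true) ≡ 𝒩)
  safe-separator T G≉T options⊆T with Ys , safes , refuted ← safe-refuters T G≉T = Ys , G⊕X≡𝒫 , refutes
    where
    X : Game
    X = mk Ys true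

    refutes : ∀ {t} → t ∈ T → o (t ⊕ X) ≡ 𝒩
    refutes {t} t∈ with Y , Y∈ , t⊕Y ← find (All.lookup refuted t∈) = ⊕-𝒩ʳ t X refl Y∈ t⊕Y

    G⊕X≡𝒫 : ∀ i → o (G i ⊕ X) ≡ 𝒫
    G⊕X≡𝒫 i = ⊕-𝒫 (G i) X (λ G'∈ → refutes (options⊆T i G'∈)) (λ Y∈ → All.lookup safes Y∈ i)

option-≉ : ∀ G H X → active X ≡ true → o (G ⊕ X) ≡ 𝒫 → o (H ⊕ X) ≡ 𝒫 → ∀ {G'} → G' ∈ options G → ¬ G' ≈ H
option-≉ G H X act G⊕X H⊕X G'∈ G'≈H = 𝒫≢𝒩 (trans (sym G⊕X) (⊕-𝒩ˡ G X act G'∈ (trans (G'≈H X) H⊕X)))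

𝒫-sums⇒⋈ : ∀ G H X → active X ≡ true → o (G ⊕ X) ≡ 𝒫 → o (H ⊕ X) ≡ 𝒫 → G ⋈ H
𝒫-sums⇒⋈ G H X act G⊕X H⊕X =
  option-≉ G H X act G⊕X H⊕X , λ H'∈ G≈H' → option-≉ H G X act H⊕X G⊕X H'∈ (λ Y → sym (G≈H' Y))

⋈∧≉⇒separator : ∀ {m n} (G : Fin m → Game) (H : Fin n → Game) → (∀ i j → G i ⋈ G j) → (∀ i j → ¬ G i ≈ H j) →
                ∃[ Xs ] (∀ i → o (G i ⊕ mk Xs true) ≡ 𝒫) × (∀ j → o (H j ⊕ mk Xs true) ≡ 𝒩)
⋈∧≉⇒separator G H ⋈s ≉s =
  let Xs , G⊕X≡𝒫 , refuted = safe-separator G (options-of-G ++ tabulate H) admissible options⊆targets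
  in  Xs , G⊕X≡𝒫 , λ j → refuted (∈-++⁺ʳ options-of-G (∈-tabulate⁺ j))
  where
  options-of-G : List Game
  options-of-G = concat (tabulate (options ∘ G))

  options⊆targets : ∀ i {G'} → G' ∈ options (G i) → G' ∈ options-of-G ++ tabulate H
  options⊆targets i G'∈ = ∈-++⁺ˡ (∈-concat⁺′ G'∈ (∈-tabulate⁺ i))

  admissible : ∀ {t} → t ∈ options-of-G ++ tabulate H → ∀ k → ¬ G k ≈ t
  admissible t∈ k with ∈-++⁻ options-of-G t∈
  ... | inj₂ t∈H with j , refl ← ∈-tabulate⁻ t∈H = ≉s k j
  ... | inj₁ t∈G
    with _ , t∈′ , ts∈ ← ∈-concat⁻′ (tabulate (options ∘ G)) t∈G
    with i , refl ← ∈-tabulate⁻ ts∈ =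
    λ Gk≈t → proj₁ (⋈s i k) t∈′ (λ Y → sym (Gk≈t Y))

theorem3p29 : (m n : ℕ) (G : Fin m → Game) (H : Fin n → Game) →
    (Σ (List Game) (λ Xs →
        (∀ i → o (G i ⊕ mk Xs true) ≡ 𝒫) × (∀ j → o (H j ⊕ mk Xs true) ≡ 𝒩)))
    ⇔
    ((∀ i j → G i ⋈ G j) × (∀ i j → ¬ (G i ≈ H j)))
theorem3p29 m n G H = mk⇔
  (λ (Xs , G⊕X≡𝒫 , H⊕X≡𝒩) →
     (λ i j → 𝒫-sums⇒⋈ (G i) (G j) (mk Xs true) refl (G⊕X≡𝒫 i) (G⊕X≡𝒫 j)) ,
     (λ i j Gi≈Hj → 𝒫≢𝒩 (trans (sym (G⊕X≡𝒫 i)) (trans (Gi≈Hj (mk Xs true)) (H⊕X≡𝒩 j)))))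
  (λ (⋈s , ≉s) → ⋈∧≉⇒separator G H ⋈s ≉s)
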